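{- For every integer $n \geq 2$, $LD(P_2 \square P_n) \geq \left\lceil \frac{3n-1}{4}\right\rceil$.
   Context: $P_n$ is the path on $n$ vertices and $\square$ the Cartesian product of graphs: $V(G_1\square G_2)=V(G_1)\times V(G_2)$, with $(u,u')\sim(v,v')$ iff ($u=v$ and $u'v'\in E(G_2)$) or ($u'=v'$ and $uv\in E(G_1)$). For a graph $G$, $C\subseteq V(G)$ and a vertex $v$, let $I(v) := N[v]\cap C$, where $N[v]$ is the closed neighborhood. $C$ is a locating-dominating set if $I(v)\neq\emptyset$ for all $v\notin C$ and $I(u)\neq I(v)$ for all distinct $u,v \notin C$. $LD(G)$ is the minimum cardinality of a locating-dominating set of $G$. -}

module Defs where

open import Data.Nat using (ℕ; zero; suc; _+_; _*_; _∸_; _≤_; NonZero)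
open import Data.Nat.DivMod using (_/_)
open import Data.Fin using (Fin; toℕ)
open import Data.Bool using (Bool; true; false; T)
open import Data.Product using (_×_; _,_; Σ; ∃; ∃-syntax)
open import Data.Sum using (_⊎_)
open import Data.List using (List; length; filter)
open import Data.Vec.Functional using () 
open import Relation.Binary.PropositionalEquality using (_≡_; _≢_)
open import Relation.Nullary using (¬_)
open import Relation.Nullary.Decidable using (Dec)

record Graph : Set₁ where
  field
    V   : Set
    Adj : V → V → Set
open Graph public

P : ℕ → Graph
P n = record { V = Fin n ; Adj = λ i j → (suc (toℕ i) ≡ toℕ j) ⊎ (suc (toℕ j) ≡ toℕ i) }

_□_ : Graph → Graph → Graph
G₁ □ G₂ = record
  { V   = V G₁ × V G₂
  ; Adj = λ { (u , u′) (v , v′) →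
        (u ≡ v × Adj G₂ u′ v′) ⊎ (u′ ≡ v′ × Adj G₁ u v) } }

_∈N[_] : {G : Graph} → V G → V G → Set
_∈N[_] {G} w v = (w ≡ v) ⊎ Adj G v w

-- I(v) = N[v] ∩ C, described by membership: w ∈ I(v) ⇔ C w × w ∈ N[v].
-- I(v) ≠ ∅ : ¬ (∀ w → C w → ¬ w ∈ N[v]).
-- I(u) ≠ I(v) : ¬ (∀ w → C w → (w ∈ N[u] ⇔ w ∈ N[v])).
record IsLocatingDominating (G : Graph) (C : V G → Set) : Set where
  field
    dominating : ∀ v → ¬ C v → ¬ (∀ w → C w → ¬ (_∈N[_] {G} w v))
    locating   : ∀ u v → ¬ C u → ¬ C v → u ≢ v →
                 ¬ (∀ w → C w → (_∈N[_] {G} w u → _∈N[_] {G} w v) × (_∈N[_] {G} w v → _∈N[_] {G} w u))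

⌈_/_⌉ : ℕ → (b : ℕ) → .{{NonZero b}} → ℕ
⌈ a / b ⌉ = (a + (b ∸ 1)) / b

-- Read P₂ □ Pₙ column by column, as a word over five letters: a position outside the grid, or
-- a grid column together with the set of its vertices in C. For a vertex outside C, domination
-- and separation from the vertex diagonally to its right and from the vertex two steps to its
-- right are conditions on a window of five consecutive letters. A potential ψ on windows of four
-- letters, checked on all 5⁵ windows, satisfies
--   ψ(next window) ≥ ψ(window) + 3 − 4·|C ∩ leaving column|
-- when the leaving letter is a grid column, and does not decrease otherwise. The word begins and
-- ends with four positions outside the grid, so ψ telescopes to 0 ≥ 3n − 4|C|.

module Submission where

open import Algebra.Properties.CommutativeSemigroup using (interchange; x∙yz≈y∙xz)
open import Data.Bool using (Bool; true; false; not; _∧_; _∨_; T)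
open import Data.Bool.Properties using (T?; T-∨; T-∧)
open import Data.Empty using (⊥; ⊥-elim)
open import Data.Fin as Fin using (Fin; combine; toℕ; fromℕ<; #_) renaming (zero to 0F; suc to sucF)
open import Data.Fin.Properties using (toℕ-injective; toℕ-fromℕ<; toℕ<n)
open import Data.List using (List; []; _∷_; length)
open import Data.List.Membership.Propositional using (_∈_)
open import Data.List.Relation.Unary.Any using (here; there)
open import Data.List.Relation.Unary.Unique.Propositional using (Unique)
open import Data.Nat as ℕ using (ℕ; zero; suc; _+_; _*_; _∸_; _≤_; _<_; _≤?_; _<?_; z≤n; s≤s; s≤s⁻¹; NonZero)
open import Data.Nat.DivMod using (_/_; _%_; m<n*o⇒m/o<n)
open import Data.Nat.Properties
  using (≤-refl; ≤-reflexive; ≤-trans; ≤-pred; +-monoˡ-≤; +-monoʳ-≤; +-mono-≤; +-monoʳ-<; *-monoʳ-≤;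
         +-cancelʳ-≤; +-cancelˡ-≡; +-comm; +-assoc; +-commutativeSemigroup; m∸n≤m; n≤1+n; m≤n+m; n<1+n;
         m<n⇒m<1+n; <⇒≱; <⇒≢; 1+n≢n; m≢1+n+m; <-cmp; m≤pred[n]⇒suc[m]≤n; module ≤-Reasoning)
open import Data.Nat.Tactic.RingSolver using (solve)
open import Data.Product using (Σ; _×_; _,_; proj₂; map₂)
open import Data.Sum using (_⊎_; inj₁; inj₂)
open import Data.Vec using (Vec; lookup) renaming ([] to []ᵥ; _∷_ to _∷ᵥ_)
open import Function using (_∘_; id; Equivalence)
open import Relation.Binary using (tri<; tri≈; tri>)
open import Relation.Binary.PropositionalEquality using (_≡_; _≢_; refl; sym; trans; cong; cong₂; subst)
open import Relation.Nullary using (¬_; contradiction; yes; no; does; _because_)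
open import Relation.Nullary.Decidable
  using (Dec; map′; _×-dec_; _→-dec_; from-yes; decidable-stable; dec-true; dec-false)
open import Relation.Nullary.Reflects using (invert)
open import Relation.Unary using (Decidable)

open import Defs

T-∨-intro : ∀ x {y} → (¬ T x → T y) → T (x ∨ y)
T-∨-intro true _ = _
T-∨-intro false f = f id

T-not-∨-intro : ∀ x {y} → (T x → T y) → T (not x ∨ y)
T-not-∨-intro true f = f _
T-not-∨-intro false _ = _

T-does⁺ : ∀ {A : Set} (a? : Dec A) → A → T (does a?)
T-does⁺ a? a = subst T (sym (dec-true a? a)) _

T-does⁻ : ∀ {A : Set} (a? : Dec A) → T (does a?) → A
T-does⁻ (true because [a]) _ = invert [a]

bit : Bool → ℕ
bit false = 0
bit true = 1

bit-∨ : ∀ x y → bit (x ∨ y) ≤ bit x + bit y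
bit-∨ true _ = s≤s z≤n
bit-∨ false _ = ≤-refl

bit≤1 : ∀ x → bit x ≤ 1
bit≤1 true = ≤-refl
bit≤1 false = z≤n

∑< : ℕ → (ℕ → ℕ) → ℕ
∑< zero f = 0
∑< (suc t) f = ∑< t f + f t

∑<-zero : ∀ t → ∑< t (λ _ → 0) ≡ 0
∑<-zero zero = refl
∑<-zero (suc t) = trans (+-comm (∑< t (λ _ → 0)) 0) (∑<-zero t)

∑<-mono : ∀ t {f g : ℕ → ℕ} → (∀ u → f u ≤ g u) → ∑< t f ≤ ∑< t g
∑<-mono zero _ = z≤n
∑<-mono (suc t) f≤g = +-mono-≤ (∑<-mono t f≤g) (f≤g t)

∑<-+ : ∀ t (f g : ℕ → ℕ) → ∑< t (λ u → f u + g u) ≡ ∑< t f + ∑< t g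
∑<-+ zero f g = refl
∑<-+ (suc t) f g =
  trans (cong (_+ (f t + g t)) (∑<-+ t f g)) (interchange +-commutativeSemigroup (∑< t f) (∑< t g) (f t) (g t))

∑<-indicator : ∀ x t → ∑< t (λ u → bit (does (x ℕ.≟ u))) ≡ bit (does (x <? t))
∑<-indicator x zero rewrite dec-false (x <? 0) (λ ()) = refl
∑<-indicator x (suc t) rewrite ∑<-indicator x t with <-cmp x t
... | tri< x<t x≢t _
  rewrite dec-true (x <? t) x<t | dec-false (x ℕ.≟ t) x≢t | dec-true (x <? suc t) (m<n⇒m<1+n x<t) = refl
... | tri≈ x≮t refl _
  rewrite dec-false (x <? x) x≮t | dec-true (x ℕ.≟ x) refl | dec-true (x <? suc x) (n<1+n x) = refl
... | tri> x≮t x≢t t<x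
  rewrite dec-false (x <? t) x≮t | dec-false (x ℕ.≟ t) x≢t | dec-false (x <? suc t) (<⇒≱ t<x ∘ s≤s⁻¹) = refl

∑<-indicator≤1 : ∀ x t → ∑< t (λ u → bit (does (x ℕ.≟ u))) ≤ 1
∑<-indicator≤1 x t = subst (_≤ 1) (sym (∑<-indicator x t)) (bit≤1 (does (x <? t)))

telescope-step : ∀ a b c d x y z → 3 * a + x ≤ 4 * b + y → y + 3 * c ≤ z + 4 * d →
                 3 * (a + c) + x ≤ 4 * (b + d) + z
telescope-step a b c d x y z ih step = begin
  3 * (a + c) + x      ≡⟨ solve (a ∷ c ∷ x ∷ []) ⟩
  (3 * a + x) + 3 * c  ≤⟨ +-monoˡ-≤ (3 * c) ih ⟩
  (4 * b + y) + 3 * c  ≡⟨ solve (b ∷ y ∷ c ∷ []) ⟩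
  4 * b + (y + 3 * c)  ≤⟨ +-monoʳ-≤ (4 * b) step ⟩
  4 * b + (z + 4 * d)  ≡⟨ solve (b ∷ z ∷ d ∷ []) ⟩
  4 * (b + d) + z      ∎
  where open ≤-Reasoning

⌈/⌉≤ : ∀ a b L .{{_ : NonZero b}} → a ≤ b * L → ⌈ a / b ⌉ ≤ L
⌈/⌉≤ a b L a≤bL = ≤-pred (m<n*o⇒m/o<n (begin-strict
  a + (b ∸ 1)      ≤⟨ +-monoˡ-≤ (b ∸ 1) a≤bL ⟩
  b * L + (b ∸ 1)  <⟨ +-monoʳ-< (b * L) (m≤pred[n]⇒suc[m]≤n ≤-refl) ⟩
  b * L + b        ≡⟨ solve (b ∷ L ∷ []) ⟩
  suc L * b        ∎))
  where open ≤-Reasoning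

-- `pad` is a position outside the grid; `col x y` is a grid column whose vertex in row 0
-- (resp. row 1) is in C iff x (resp. y).
data Column : Set where
  pad : Column
  col : Bool → Bool → Column

other : Fin 2 → Fin 2
other 0F = # 1
other (sucF 0F) = 0F

other-involutive : ∀ r → other (other r) ≡ r
other-involutive 0F = refl
other-involutive (sucF 0F) = refl

inC : Column → Fin 2 → Bool
inC pad _ = false
inC (col x _) 0F = x
inC (col _ y) (sucF 0F) = y

inC-col : (f : Fin 2 → Bool) → ∀ r → inC (col (f 0F) (f (# 1))) r ≡ f r
inC-col f 0F = refl
inC-col f (sucF 0F) = refl

inGrid : Column → Bool
inGrid pad = false
inGrid (col _ _) = true

width : Column → ℕ
width pad = 0
width (col _ _) = 1

weight : Column → ℕ
weight pad = 0
weight (col x y) = bit x + bit y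

-- Conditions on the vertex in row r of column c₀ when it is not in C. A pair of vertices
-- outside C is separated iff C meets the symmetric difference of their closed neighbourhoods;
-- only the two pairs below are needed for the bound.
dominatedAt : Fin 2 → Column → Column → Column → Bool
dominatedAt r c₋₁ c₀ c₁ = inC c₋₁ r ∨ (inC c₁ r ∨ inC c₀ (other r))

separatedFromDiagonal : Fin 2 → Column → Column → Column → Bool
separatedFromDiagonal r c₋₁ c₁ c₂ = not (inGrid c₁) ∨ (inC c₁ (other r) ∨ (inC c₋₁ r ∨ inC c₂ (other r)))

separatedAlongRow : Fin 2 → Column → Column → Column → Column → Column → Bool
separatedAlongRow r c₋₁ c₀ c₁ c₂ c₃ =
  not (inGrid c₂) ∨ (inC c₂ r ∨ (inC c₋₁ r ∨ (inC c₀ (other r) ∨ (inC c₃ r ∨ inC c₂ (other r)))))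

rowLocated : Fin 2 → Column → Column → Column → Column → Column → Bool
rowLocated r c₋₁ c₀ c₁ c₂ c₃ =
  inC c₀ r ∨ (dominatedAt r c₋₁ c₀ c₁ ∧ (separatedFromDiagonal r c₋₁ c₁ c₂ ∧ separatedAlongRow r c₋₁ c₀ c₁ c₂ c₃))

locallyLocating : Column → Column → Column → Column → Column → Bool
locallyLocating c₋₁ c₀ c₁ c₂ c₃ =
  not (inGrid c₀) ∨ (rowLocated 0F c₋₁ c₀ c₁ c₂ c₃ ∧ rowLocated (# 1) c₋₁ c₀ c₁ c₂ c₃)

code : Column → Fin 5
code pad = 0F
code (col false false) = # 1
code (col false true) = # 2
code (col true false) = # 3
code (col true true) = # 4

-- The values are longest-path potentials in the graph of windows whose
-- edges are the inequalities of potential-step.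
potentialTable : Vec ℕ 25
potentialTable =
  3344566663445664465665666 ∷ᵥ
  6666666666666666666633333 ∷ᵥ
  4455666664556666666666666 ∷ᵥ
  4455666664666665566666666 ∷ᵥ
  6666655666666666666666666 ∷ᵥ
  0011233330112331132332333 ∷ᵥ
  6666666666666666666600000 ∷ᵥ
  1122366361223336636333333 ∷ᵥ
  1122366631666332233333333 ∷ᵥ
  3333322333333333333333333 ∷ᵥ
  4455666664556665566666666 ∷ᵥ
  6666666666666666646444444 ∷ᵥ
  5566666665666666666666666 ∷ᵥ
  5566666565666666666666666 ∷ᵥ
  6666666666666666666666666 ∷ᵥ
  4455666664556665566666666 ∷ᵥ
  6666666666666446666644444 ∷ᵥ
  5566666655666666666666666 ∷ᵥ
  5566666665666666666666666 ∷ᵥ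
  6666666666666666666666666 ∷ᵥ
  6666666666666666666666666 ∷ᵥ
  5566666665666666666666666 ∷ᵥ
  6666666666666666666666666 ∷ᵥ
  6666666666666666666666666 ∷ᵥ
  6666666666666666666666666 ∷ᵥ []ᵥ

digitFromRight : ℕ → ℕ → ℕ
digitFromRight zero x = x % 10
digitFromRight (suc k) x = digitFromRight k (x / 10)

potential : Column → Column → Column → Column → ℕ
potential a b c d =
  digitFromRight (24 ∸ toℕ (combine (code c) (code d))) (lookup potentialTable (combine (code a) (code b)))

∀-Column? : {P : Column → Set} → Decidable P → Dec (∀ c → P c)
∀-Column? P? =
  map′ (λ (p₀ , p₁ , p₂ , p₃ , p₄) → λ { pad → p₀ ; (col false false) → p₁ ; (col false true) → p₂
                                       ; (col true false) → p₃ ; (col true true) → p₄ })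
       (λ p → p pad , p (col false false) , p (col false true) , p (col true false) , p (col true true))
       (P? pad ×-dec P? (col false false) ×-dec P? (col false true) ×-dec P? (col true false) ×-dec P? (col true true))

potential-step : ∀ a b c d e → T (locallyLocating a b c d e) →
                 potential a b c d + 3 * width a ≤ potential b c d e + 4 * weight a
potential-step = from-yes
  (∀-Column? λ a → ∀-Column? λ b → ∀-Column? λ c → ∀-Column? λ d → ∀-Column? λ e →
     T? (locallyLocating a b c d e) →-dec potential a b c d + 3 * width a ≤? potential b c d e + 4 * weight a)

windowPotential : (ℕ → Column) → ℕ → ℕ
windowPotential w t = potential (w t) (w (1 + t)) (w (2 + t)) (w (3 + t))

LocallyLocatingWord : (ℕ → Column) → Set
LocallyLocatingWord w = ∀ t → T (locallyLocating (w t) (w (1 + t)) (w (2 + t)) (w (3 + t)) (w (4 + t)))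

module _ {w : ℕ → Column} (locating : LocallyLocatingWord w) where

  private
    Ψ : ℕ → ℕ
    Ψ = windowPotential w

  amortized : ∀ t → 3 * ∑< t (width ∘ w) + Ψ 0 ≤ 4 * ∑< t (weight ∘ w) + Ψ t
  amortized zero = ≤-refl
  amortized (suc t) =
    telescope-step (∑< t (width ∘ w)) (∑< t (weight ∘ w)) (width (w t)) (weight (w t)) (Ψ 0) (Ψ t) (Ψ (suc t))
      (amortized t) (potential-step (w t) (w (1 + t)) (w (2 + t)) (w (3 + t)) (w (4 + t)) (locating t))

  width-weight-bound : ∀ t → Ψ t ≤ Ψ 0 → 3 * ∑< t (width ∘ w) ≤ 4 * ∑< t (weight ∘ w)
  width-weight-bound t Ψt≤Ψ₀ =
    +-cancelʳ-≤ _ _ _ (≤-trans (amortized t) (+-monoʳ-≤ (4 * ∑< t (weight ∘ w)) Ψt≤Ψ₀))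

data Near : Fin 2 → ℕ → Fin 2 → ℕ → Set where
  same   : ∀ {r p} → Near r p r p
  across : ∀ {r p} → Near (other r) p r p
  next   : ∀ {r p} → Near r (suc p) r p
  prev   : ∀ {r p} → Near r p r (suc p)

adjacent-rows : ∀ {r s} → Adj (P 2) r s → s ≡ other r
adjacent-rows {0F} {0F} (inj₁ ())
adjacent-rows {0F} {0F} (inj₂ ())
adjacent-rows {0F} {sucF 0F} _ = refl
adjacent-rows {sucF 0F} {0F} _ = refl
adjacent-rows {sucF 0F} {sucF 0F} (inj₁ ())
adjacent-rows {sucF 0F} {sucF 0F} (inj₂ ())

other-adjacent : ∀ r → Adj (P 2) r (other r)
other-adjacent 0F = inj₁ refl
other-adjacent (sucF 0F) = inj₂ refl

module _ {n : ℕ} where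

  -- Column k of the grid is letter 4 + k of the word, so that the windows at positions 0 and
  -- 4 + n consist of pads only.
  pos : Fin n → ℕ
  pos i = 4 + toℕ i

  toNear : ∀ {r s} {i j : Fin n} → _∈N[_] {P 2 □ P n} (s , j) (r , i) → Near s (pos j) r (pos i)
  toNear (inj₁ refl) = same
  toNear {r} {i = i} (inj₂ (inj₁ (refl , inj₁ 1+i≡j))) = subst (λ x → Near r (4 + x) r (pos i)) 1+i≡j next
  toNear {r} {j = j} (inj₂ (inj₁ (refl , inj₂ 1+j≡i))) = subst (λ x → Near r (pos j) r (4 + x)) 1+j≡i prev
  toNear {r} (inj₂ (inj₂ (refl , r~s))) = subst (λ x → Near x _ r _) (sym (adjacent-rows r~s)) across

  fromNear : ∀ {s r u p} {i j : Fin n} → Near s u r p → pos j ≡ u → pos i ≡ p → _∈N[_] {P 2 □ P n} (s , j) (r , i)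
  fromNear {r = r} same pos[j]≡p pos[i]≡p =
    inj₁ (cong (r ,_) (toℕ-injective (+-cancelˡ-≡ 4 _ _ (trans pos[j]≡p (sym pos[i]≡p)))))
  fromNear {r = r} across pos[j]≡p pos[i]≡p =
    inj₂ (inj₂ (toℕ-injective (+-cancelˡ-≡ 4 _ _ (trans pos[i]≡p (sym pos[j]≡p))) , other-adjacent r))
  fromNear next pos[j]≡1+p pos[i]≡p =
    inj₂ (inj₁ (refl , inj₁ (+-cancelˡ-≡ 4 _ _ (trans (cong suc pos[i]≡p) (sym pos[j]≡1+p)))))
  fromNear prev pos[j]≡u pos[i]≡1+u =
    inj₂ (inj₁ (refl , inj₂ (+-cancelˡ-≡ 4 _ _ (trans (cong suc pos[j]≡u) (sym pos[i]≡1+u)))))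

  marked : List (Fin 2 × Fin n) → Fin 2 → ℕ → Bool
  marked [] r u = false
  marked ((s , j) ∷ L) r u = (does (s Fin.≟ r) ∧ does (pos j ℕ.≟ u)) ∨ marked L r u

  ∈⇒marked : ∀ {L r j} → (r , j) ∈ L → T (marked L r (pos j))
  ∈⇒marked {(r , j) ∷ L} (here refl) =
    Equivalence.from T-∨ (inj₁ (Equivalence.from T-∧ (T-does⁺ (r Fin.≟ r) refl , T-does⁺ (pos j ℕ.≟ pos j) refl)))
  ∈⇒marked {_ ∷ L} (there r,j∈L) = Equivalence.from T-∨ (inj₂ (∈⇒marked r,j∈L))

  marked⇒∈ : ∀ {L r u} → T (marked L r u) → Σ (Fin n) λ j → pos j ≡ u × (r , j) ∈ L
  marked⇒∈ {(s , j) ∷ L} {r} {u} m with Equivalence.to T-∨ m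
  ... | inj₁ s,j-marked with Equivalence.to T-∧ s,j-marked
  ...   | s≡r , pos[j]≡u = j , T-does⁻ (pos j ℕ.≟ u) pos[j]≡u , here (cong (_, j) (sym (T-does⁻ (s Fin.≟ r) s≡r)))
  marked⇒∈ {(s , j) ∷ L} {r} {u} m | inj₂ marked-later = map₂ (map₂ there) (marked⇒∈ marked-later)

  word : List (Fin 2 × Fin n) → ℕ → Column
  word L (suc (suc (suc (suc k)))) with k <? n
  ... | yes _ = col (marked L 0F (4 + k)) (marked L (# 1) (4 + k))
  ... | no _  = pad
  word L _ = pad

  word-inside : ∀ L {k} → k < n → word L (4 + k) ≡ col (marked L 0F (4 + k)) (marked L (# 1) (4 + k))
  word-inside L {k} k<n with k <? n
  ... | yes _ = refl
  ... | no k≮n = contradiction k<n k≮n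

  word-beyond : ∀ L {k} → n ≤ k → word L (4 + k) ≡ pad
  word-beyond L {k} n≤k with k <? n
  ... | yes k<n = contradiction refl (<⇒≢ (≤-trans k<n n≤k))
  ... | no _ = refl

  word-view : ∀ L u → word L u ≡ pad ⊎ Σ (Fin n) λ i → pos i ≡ u × word L u ≡ col (marked L 0F u) (marked L (# 1) u)
  word-view L (suc (suc (suc (suc k)))) with k <? n
  ... | yes k<n = inj₂ (fromℕ< k<n , cong (4 +_) (toℕ-fromℕ< k<n) , refl)
  ... | no _ = inj₁ refl
  word-view L 0 = inj₁ refl
  word-view L 1 = inj₁ refl
  word-view L 2 = inj₁ refl
  word-view L 3 = inj₁ refl

  grid-position : ∀ L {u} → T (inGrid (word L u)) → Σ (Fin n) λ i → pos i ≡ u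
  grid-position L {u} g with word-view L u
  ... | inj₁ eq rewrite eq = ⊥-elim g
  ... | inj₂ (i , eq , _) = i , eq

  ∈⇒inC-word : ∀ {L r j} → (r , j) ∈ L → T (inC (word L (pos j)) r)
  ∈⇒inC-word {L} {r} {j} r,j∈L
    rewrite word-inside L (toℕ<n j) | inC-col (λ s → marked L s (pos j)) r = ∈⇒marked r,j∈L

  inC-word⇒∈ : ∀ {L r u} → T (inC (word L u) r) → Σ (Fin n) λ j → pos j ≡ u × (r , j) ∈ L
  inC-word⇒∈ {L} {r} {u} m with word-view L u
  ... | inj₁ eq rewrite eq = ⊥-elim m
  ... | inj₂ (_ , _ , eq) rewrite eq | inC-col (λ s → marked L s u) r = marked⇒∈ m

  markCount : List (Fin 2 × Fin n) → ℕ → ℕ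
  markCount L u = bit (marked L 0F u) + bit (marked L (# 1) u)

  weight≤markCount : ∀ L u → weight (word L u) ≤ markCount L u
  weight≤markCount L u with word-view L u
  ... | inj₁ eq rewrite eq = z≤n
  ... | inj₂ (_ , _ , eq) rewrite eq = ≤-refl

  markCount-∷ : ∀ s j L u → markCount ((s , j) ∷ L) u ≤ bit (does (pos j ℕ.≟ u)) + markCount L u
  markCount-∷ 0F j L u = begin
    bit (e ∨ m₀) + bit m₁      ≤⟨ +-monoˡ-≤ (bit m₁) (bit-∨ e m₀) ⟩
    (bit e + bit m₀) + bit m₁  ≡⟨ +-assoc (bit e) (bit m₀) (bit m₁) ⟩
    bit e + (bit m₀ + bit m₁)  ∎
    where
    open ≤-Reasoning
    e = does (pos j ℕ.≟ u)
    m₀ = marked L 0F u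
    m₁ = marked L (# 1) u
  markCount-∷ (sucF 0F) j L u = begin
    bit m₀ + bit (e ∨ m₁)      ≤⟨ +-monoʳ-≤ (bit m₀) (bit-∨ e m₁) ⟩
    bit m₀ + (bit e + bit m₁)  ≡⟨ x∙yz≈y∙xz +-commutativeSemigroup (bit m₀) (bit e) (bit m₁) ⟩
    bit e + (bit m₀ + bit m₁)  ∎
    where
    open ≤-Reasoning
    e = does (pos j ℕ.≟ u)
    m₀ = marked L 0F u
    m₁ = marked L (# 1) u

  ∑<-markCount : ∀ L t → ∑< t (markCount L) ≤ length L
  ∑<-markCount [] t = ≤-reflexive (∑<-zero t)
  ∑<-markCount ((s , j) ∷ L) t = begin
    ∑< t (markCount ((s , j) ∷ L))                               ≤⟨ ∑<-mono t (markCount-∷ s j L) ⟩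
    ∑< t (λ u → bit (does (pos j ℕ.≟ u)) + markCount L u)        ≡⟨ ∑<-+ t _ _ ⟩
    ∑< t (λ u → bit (does (pos j ℕ.≟ u))) + ∑< t (markCount L)  ≤⟨ +-mono-≤ (∑<-indicator≤1 (pos j) t) (∑<-markCount L t) ⟩
    suc (length L)                                               ∎
    where open ≤-Reasoning

  ∑<-weight : ∀ L t → ∑< t (weight ∘ word L) ≤ length L
  ∑<-weight L t = ≤-trans (∑<-mono t (weight≤markCount L)) (∑<-markCount L t)

  ∑<-width : ∀ L k → k ≤ n → ∑< (4 + k) (width ∘ word L) ≡ k
  ∑<-width L zero _ = refl
  ∑<-width L (suc k) k<n =
    trans (cong₂ _+_ (∑<-width L k (≤-trans (n≤1+n k) k<n)) (cong width (word-inside L k<n))) (+-comm k 1)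

  window-beyond : ∀ L → windowPotential (word L) (4 + n) ≡ windowPotential (word L) 0
  window-beyond L
    rewrite word-beyond L (≤-refl {n}) | word-beyond L (n≤1+n n)
          | word-beyond L (m≤n+m n 2) | word-beyond L (m≤n+m n 3) = refl

module _ {n : ℕ} {C : List (Fin 2 × Fin n)} (ld : IsLocatingDominating (P 2 □ P n) (_∈ C)) where

  open IsLocatingDominating ld

  private
    marks : Fin 2 → ℕ → Bool
    marks s u = inC (word C u) s

    Marked : Fin 2 → ℕ → Set
    Marked s u = T (marks s u)

    OnGrid : ℕ → Set
    OnGrid u = T (inGrid (word C u))

  dominated : ∀ {r p} → OnGrid p → ¬ Marked r p → ¬ (∀ {s u} → Marked s u → ¬ Near s u r p)
  dominated {r} {p} g ¬m undominated with grid-position C {p} g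
  ... | i , refl =
    dominating (r , i) (¬m ∘ ∈⇒inC-word) λ { (s , j) m near → undominated (∈⇒inC-word m) (toNear near) }

  separated : ∀ {r p r′ p′} → OnGrid p → OnGrid p′ → ¬ Marked r p → ¬ Marked r′ p′ → (r , p) ≢ (r′ , p′) →
              (∀ {s u} → Marked s u → Near s u r p → Near s u r′ p′) →
              (∀ {s u} → Marked s u → Near s u r′ p′ → Near s u r p) → ⊥
  separated {r} {p} {r′} {p′} g g′ ¬m ¬m′ distinct to from with grid-position C {p} g | grid-position C {p′} g′
  ... | i , refl | i′ , refl =
    locating (r , i) (r′ , i′) (¬m ∘ ∈⇒inC-word) (¬m′ ∘ ∈⇒inC-word) (distinct ∘ cong λ (s , j) → s , pos j)
      λ { (s , j) m → (λ near → fromNear (to (∈⇒inC-word m) (toNear near)) refl refl)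
                    , (λ near → fromNear (from (∈⇒inC-word m) (toNear near)) refl refl) }

  row-located : ∀ t r → OnGrid (1 + t) →
    T (rowLocated r (word C t) (word C (1 + t)) (word C (2 + t)) (word C (3 + t)) (word C (4 + t)))
  row-located t r g = T-∨-intro (marks r (1 + t)) λ ¬m →
    Equivalence.from T-∧ (is-dominated ¬m , Equivalence.from T-∧ (separated-diagonally ¬m , separated-along-row ¬m))
    where
    r′ = other r

    is-dominated : ¬ Marked r (1 + t) → T (dominatedAt r (word C t) (word C (1 + t)) (word C (2 + t)))
    is-dominated ¬m =
      T-∨-intro (marks r t) λ ¬left → T-∨-intro (marks r (2 + t)) λ ¬right → decidable-stable (T? _) λ ¬across →
      dominated {r} {1 + t} g ¬m λ where
        m same → ¬m m
        m across → ¬across m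
        m next → ¬right m
        m prev → ¬left m

    separated-diagonally : ¬ Marked r (1 + t) → T (separatedFromDiagonal r (word C t) (word C (2 + t)) (word C (3 + t)))
    separated-diagonally ¬m =
      T-not-∨-intro (inGrid (word C (2 + t))) λ g′ →
      T-∨-intro (marks r′ (2 + t)) λ ¬m′ → T-∨-intro (marks r t) λ ¬left → decidable-stable (T? _) λ ¬far →
      separated {r} {1 + t} {r′} {2 + t} g g′ ¬m ¬m′ (1+n≢n ∘ sym ∘ cong proj₂)
        (λ where
          m same → ⊥-elim (¬m m)
          m across → prev
          m next → subst (λ x → Near x (2 + t) r′ (2 + t)) (other-involutive r) across
          m prev → ⊥-elim (¬left m))
        (λ where
          m same → ⊥-elim (¬m′ m)
          m across → subst (λ x → Near x (2 + t) r (1 + t)) (sym (other-involutive r)) next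
          m next → ⊥-elim (¬far m)
          m prev → across)

    separated-along-row : ¬ Marked r (1 + t) →
      T (separatedAlongRow r (word C t) (word C (1 + t)) (word C (2 + t)) (word C (3 + t)) (word C (4 + t)))
    separated-along-row ¬m =
      T-not-∨-intro (inGrid (word C (3 + t))) λ g′ →
      T-∨-intro (marks r (3 + t)) λ ¬m′ → T-∨-intro (marks r t) λ ¬left → T-∨-intro (marks r′ (1 + t)) λ ¬across →
      T-∨-intro (marks r (4 + t)) λ ¬far → decidable-stable (T? _) λ ¬far-across →
      separated {r} {1 + t} {r} {3 + t} g g′ ¬m ¬m′ (m≢1+n+m (suc t) {1} ∘ cong proj₂)
        (λ where
          m same → ⊥-elim (¬m m)
          m across → ⊥-elim (¬across m)
          m next → prev
          m prev → ⊥-elim (¬left m))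
        (λ where
          m same → ⊥-elim (¬m′ m)
          m across → ⊥-elim (¬far-across m)
          m next → ⊥-elim (¬far m)
          m prev → next)

  word-locating : LocallyLocatingWord (word C)
  word-locating t = T-not-∨-intro (inGrid (word C (1 + t))) λ g →
    Equivalence.from T-∧ (row-located t 0F g , row-located t (# 1) g)

lemma4p6 : (n : ℕ) → 2 ≤ n → (C : List (V (P 2 □ P n))) → Unique C →
    IsLocatingDominating (P 2 □ P n) (λ v → v ∈ C) →
    ⌈ 3 * n ∸ 1 / 4 ⌉ ≤ length C
lemma4p6 n _ C _ ld = ⌈/⌉≤ (3 * n ∸ 1) 4 (length C) (begin
  3 * n ∸ 1                          ≤⟨ m∸n≤m (3 * n) 1 ⟩
  3 * n                              ≡⟨ cong (3 *_) (sym (∑<-width C n ≤-refl)) ⟩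
  3 * ∑< (4 + n) (width ∘ word C)    ≤⟨ width-weight-bound (word-locating ld) (4 + n) (≤-reflexive (window-beyond C)) ⟩
  4 * ∑< (4 + n) (weight ∘ word C)   ≤⟨ *-monoʳ-≤ 4 (∑<-weight C (4 + n)) ⟩
  4 * length C                       ∎)
  where open ≤-Reasoning
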